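{- Let $(G,w,w_e)$ be a connected graph with weights $w:V(G)\to[0,\infty)$ and $w_e:E(G)\to[0,\infty)$, let $c\in V(G)$, let $C=[c]_R=\{c_1,\ldots,c_k\}$ and $N(c)=\{n_1,\ldots,n_s\}$. Let $G'=G\setminus(C\setminus\{c\})$ (delete the vertices of $C$ other than $c$), define $w':V(G')\to[0,\infty)$ by $w'(c)=\sum_{i=1}^k w(c_i)$ and $w'(v)=w(v)$ for $v\in V(G)\setminus C$, and define $w_e':E(G')\to[0,\infty)$ by $w_e'(cn_j)=\sum_{i=1}^k w_e(c_in_j)$ for $j\in\{1,\ldots,s\}$ and $w_e'(e)=w_e(e)$ for $e\in E(G)\setminus I(C)$. Then $$W_{ve}(G,w,w_e)=W_{ve}(G',w',w_e')+\sum_{i=1}^k\ \sum_{c_r\in C\setminus\{c_i\}}\ \sum_{e\in I(c_r)}w(c_i)w_e(e).$$ Moreover, if $w(c_i)=a$ for all $i\in\{1,\ldots,k\}$ and $w_e(e)=b$ for all $e\in I(C)$, where $a,b\in[0,\infty)$, then $$W_{ve}(G,w,w_e)=W_{ve}(G',w',w_e')+abk(k-1)s.$$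
   Context: All graphs are finite and simple; $N(v)$ is the set of neighbours of $v$, and $d_G(u,v)$ is the shortest-path distance. For a vertex $v$ and an edge $e=xy$, $d_G(v,e)=\min\{d_G(v,x),d_G(v,y)\}$, and $W_{ve}(G,w,w_e)=\sum_{v\in V(G)}\sum_{e\in E(G)}w(v)w_e(e)d_G(v,e)$. Vertices $u,v$ are in relation $R$ if $N(u)=N(v)$; this is an equivalence relation, and $[v]_R$ denotes the class of $v$. With $C$ and $N(c)$ as in the claim (all $c_i$ have neighbourhood $N(c)$), let $I(c_i)=\{c_in_j: j=1,\ldots,s\}$ (edges incident to $c_i$) and $I(C)=\bigcup_{i=1}^k I(c_i)$ (edges incident to a vertex of $C$). -}

module Defs where

open import Level using (Level)
open import Data.Nat as ℕ using (ℕ; zero; suc; _∸_)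
open import Data.Fin using (Fin; toℕ; _≟_)
import Data.Fin
open import Data.Fin.Properties using (_<?_)
open import Data.Bool using (Bool; true; false; _∧_; _∨_; not; if_then_else_)
open import Relation.Nullary.Decidable using (⌊_⌋)
open import Relation.Binary.PropositionalEquality using (_≡_)
open import Algebra.Bundles using (CommutativeSemiring)

record Graph (n : ℕ) : Set where
  field
    adj : Fin n → Fin n → Bool
    adj-sym : ∀ u v → adj u v ≡ adj v u
    adj-irr : ∀ v → adj v v ≡ false
open Graph public

anyF : ∀ {n} → (Fin n → Bool) → Bool
anyF {zero} p = false
anyF {suc n} p = p Data.Fin.zero ∨ anyF (λ i → p (Data.Fin.suc i))

allF : ∀ {n} → (Fin n → Bool) → Bool
allF {zero} p = true
allF {suc n} p = p Data.Fin.zero ∧ allF (λ i → p (Data.Fin.suc i))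

countF : ∀ {n} → (Fin n → Bool) → ℕ
countF {zero} p = zero
countF {suc n} p = (if p Data.Fin.zero then 1 else 0) ℕ.+ countF (λ i → p (Data.Fin.suc i))

eqB : ∀ {n} → Fin n → Fin n → Bool
eqB u v = ⌊ u ≟ v ⌋

ltB : ∀ {n} → Fin n → Fin n → Bool
ltB u v = ⌊ u <? v ⌋

minF maxF : ∀ {n} → Fin n → Fin n → Fin n
minF u v = if ltB u v then u else v
maxF u v = if ltB u v then v else u

-- Induced subgraph of G on the vertices with keep v ≡ true.
-- reach G keep k u v : there is a walk of length ≤ k from u to v using only
-- kept vertices.
reach : ∀ {n} → Graph n → (Fin n → Bool) → ℕ → Fin n → Fin n → Bool
reach G keep zero u v = keep u ∧ eqB u v
reach G keep (suc k) u v =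
  reach G keep k u v ∨ anyF (λ x → reach G keep k u x ∧ (adj G x v ∧ keep v))

-- Shortest-path distance in the induced subgraph (least k with a walk of
-- length ≤ k; value n if there is none, which never happens when connected).
distFrom : ∀ {n} → Graph n → (Fin n → Bool) → Fin n → Fin n → ℕ → ℕ → ℕ
distFrom G keep u v k zero = k
distFrom G keep u v k (suc fuel) =
  if reach G keep k u v then k else distFrom G keep u v (suc k) fuel

dist : ∀ {n} → Graph n → (Fin n → Bool) → Fin n → Fin n → ℕ
dist {n} G keep u v = distFrom G keep u v 0 n

allV : ∀ {n} → Fin n → Bool
allV _ = true

Connected : ∀ {n} → Graph n → Set
Connected {n} G = ∀ u v → reach G allV n u v ≡ true

sameN : ∀ {n} → Graph n → Fin n → Fin n → Bool
sameN G u v = allF (λ x → ⌊ Data.Bool._≟_ (adj G u x) (adj G v x) ⌋)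
  where import Data.Bool

isEdge : ∀ {n} → Graph n → (Fin n → Bool) → Fin n → Fin n → Bool
isEdge G keep x y = ltB x y ∧ (adj G x y ∧ (keep x ∧ keep y))

module _ {c ℓ : Level} (R : CommutativeSemiring c ℓ) where
  open CommutativeSemiring R

  Σ : ∀ {n} → (Fin n → Carrier) → Carrier
  Σ {zero} f = 0#
  Σ {suc n} f = f Data.Fin.zero + Σ (λ i → f (Data.Fin.suc i))

  ind : Bool → Carrier → Carrier
  ind b x = if b then x else 0#

  fromℕ : ℕ → Carrier
  fromℕ zero = 0#
  fromℕ (suc m) = 1# + fromℕ m

  -- An edge weight is a function Fin n → Fin n → Carrier, where the weight of
  -- the edge {x,y} is read at (min x y , max x y); other values are ignored.
  ew : ∀ {n} → (Fin n → Fin n → Carrier) → Fin n → Fin n → Carrier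
  ew we x y = we (minF x y) (maxF x y)

  Wve : ∀ {n} → Graph n → (Fin n → Bool) → (Fin n → Carrier)
      → (Fin n → Fin n → Carrier) → Carrier
  Wve G keep w we =
    Σ (λ v → ind (keep v) (Σ (λ x → Σ (λ y → ind (isEdge G keep x y)
      ((w v * ew we x y) * fromℕ (ℕ._⊓_ (dist G keep v x) (dist G keep v y)))))))

-- The twins c_i in C = [c₀]_R have the same neighbours, so they are pairwise
-- non-adjacent and every walk through a deleted twin can be rerouted through c₀:
-- deleting C ∖ {c₀} changes no distance among the remaining vertices, and all twins
-- have the same distances to the vertices outside C.  Split W_ve into the edges
-- avoiding C and the edges c_r n_j incident to C.  For v outside C, d(v, c_r n_j) does
-- not depend on r, so these edges merge into c₀ n_j with the summed weight w_e'.  The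
-- twins jointly see the edges avoiding C exactly as c₀ sees them in G', which
-- accounts for w'(c₀).  What remains are the edges at the other twins c_r, r ≠ i,
-- each at distance exactly 1 from c_i (edges at c_i itself are at distance 0);
-- with constant weights there are k(k-1)s such pairs.

module Submission where

open import Defs
open import Level using (Level)
open import Data.Nat as ℕ using (ℕ; zero; suc; _≤_; _∸_; _⊓_)
open import Data.Nat.Properties using (≤-refl; <⇒≤; ⊓-comm; m≥n⇒m⊓n≡n)
open import Data.Fin as Fin using (Fin; _≟_)
open import Data.Fin.Properties using (suc-injective; <-cmp; <-asym)
open import Data.Bool using (Bool; true; false; _∧_; _∨_; not; if_then_else_)
open import Data.Bool.Properties
  using (∧-comm; ∧-identityʳ; ∧-conicalˡ; ∧-conicalʳ; not-injective; ⇔→≡)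
import Data.Bool.Properties as Bool
open import Data.Product using (∃; _×_; _,_)
open import Data.Sum using (_⊎_; inj₁; inj₂)
open import Data.Empty using (⊥-elim)
open import Function using (_∘_)
open import Function.Bundles using (mk⇔)
open import Relation.Nullary using (Dec; yes; no; ¬_)
open import Relation.Nullary.Decidable using (isYes; dec-true; dec-false; isYes≗does; ⌊⌋-map′)
open import Relation.Binary using (tri<; tri≈; tri>)
open import Relation.Binary.PropositionalEquality as ≡ using (_≡_; _≢_)
open import Algebra.Bundles using (CommutativeSemiring)

module _ {a} {A : Set a} where

  isYes⇒ : (a? : Dec A) → isYes a? ≡ true → A
  isYes⇒ (yes a) _ = a

  ⇒isYes : (a? : Dec A) → A → isYes a? ≡ true
  ⇒isYes a? a = ≡.trans (isYes≗does a?) (dec-true a? a)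

  ¬⇒isNo : (a? : Dec A) → ¬ A → isYes a? ≡ false
  ¬⇒isNo a? ¬a = ≡.trans (isYes≗does a?) (dec-false a? ¬a)

eqB-refl : ∀ {n} (u : Fin n) → eqB u u ≡ true
eqB-refl u = ⇒isYes (u ≟ u) ≡.refl

eqB-sound : ∀ {n} {u v : Fin n} → eqB u v ≡ true → u ≡ v
eqB-sound {u = u} {v} = isYes⇒ (u ≟ v)

eqB-false : ∀ {n} {u v : Fin n} → u ≢ v → eqB u v ≡ false
eqB-false {u = u} {v} = ¬⇒isNo (u ≟ v)

eqB-suc : ∀ {n} (i j : Fin n) → eqB (Fin.suc i) (Fin.suc j) ≡ eqB i j
eqB-suc i j = ⌊⌋-map′ (≡.cong Fin.suc) suc-injective (i ≟ j)

true≢false : true ≢ false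
true≢false ()

ltB-flip : ∀ {n} {x y : Fin n} → x ≢ y → ltB y x ≡ not (ltB x y)
ltB-flip {x = x} {y} x≢y with x Fin.<? y | y Fin.<? x
... | yes x<y | yes y<x = ⊥-elim (<-asym x<y y<x)
... | yes _ | no _ = ≡.refl
... | no _ | yes _ = ≡.refl
... | no x≮y | no y≮x with <-cmp x y
...   | tri< x<y _ _ = ⊥-elim (x≮y x<y)
...   | tri≈ _ x≡y _ = ⊥-elim (x≢y x≡y)
...   | tri> _ _ y<x = ⊥-elim (y≮x y<x)

minF-maxF-comm : ∀ {n a} {A : Set a} (f : Fin n → Fin n → A) x y →
                 f (minF x y) (maxF x y) ≡ f (minF y x) (maxF y x)
minF-maxF-comm f x y with x ≟ y
... | yes ≡.refl = ≡.refl
... | no x≢y rewrite ltB-flip x≢y with ltB x y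
...   | true = ≡.refl
...   | false = ≡.refl

∨-true : ∀ a {b} → a ∨ b ≡ true → a ≡ true ⊎ b ≡ true
∨-true true _ = inj₁ ≡.refl
∨-true false b≡true = inj₂ b≡true

∨-trueˡ : ∀ {a} b → a ≡ true → a ∨ b ≡ true
∨-trueˡ b ≡.refl = ≡.refl

∨-trueʳ : ∀ a {b} → b ≡ true → a ∨ b ≡ true
∨-trueʳ a ≡.refl = Bool.∨-zeroʳ a

∧-true : ∀ {a b} → a ≡ true → b ≡ true → a ∧ b ≡ true
∧-true ≡.refl ≡.refl = ≡.refl

anyF-witness : ∀ {n} (p : Fin n → Bool) → anyF p ≡ true → ∃ λ i → p i ≡ true
anyF-witness {suc n} p any with ∨-true (p Fin.zero) any
... | inj₁ p₀ = Fin.zero , p₀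
... | inj₂ rest with anyF-witness (p ∘ Fin.suc) rest
...   | i , pᵢ = Fin.suc i , pᵢ

anyF-intro : ∀ {n} (p : Fin n → Bool) i → p i ≡ true → anyF p ≡ true
anyF-intro p Fin.zero pᵢ rewrite pᵢ = ≡.refl
anyF-intro p (Fin.suc i) pᵢ = ∨-trueʳ (p Fin.zero) (anyF-intro (p ∘ Fin.suc) i pᵢ)

anyF-cong : ∀ {n} {p q : Fin n → Bool} → (∀ i → p i ≡ q i) → anyF p ≡ anyF q
anyF-cong {zero} p≗q = ≡.refl
anyF-cong {suc n} p≗q = ≡.cong₂ _∨_ (p≗q Fin.zero) (anyF-cong (p≗q ∘ Fin.suc))

allF-elim : ∀ {n} (p : Fin n → Bool) → allF p ≡ true → ∀ i → p i ≡ true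
allF-elim p all Fin.zero = ∧-conicalˡ _ _ all
allF-elim p all (Fin.suc i) = allF-elim (p ∘ Fin.suc) (∧-conicalʳ _ _ all) i

allF-intro : ∀ {n} (p : Fin n → Bool) → (∀ i → p i ≡ true) → allF p ≡ true
allF-intro {zero} p _ = ≡.refl
allF-intro {suc n} p all = ∧-true (all Fin.zero) (allF-intro (p ∘ Fin.suc) (all ∘ Fin.suc))

countF-cong : ∀ {n} {p q : Fin n → Bool} → (∀ i → p i ≡ q i) → countF p ≡ countF q
countF-cong {zero} p≗q = ≡.refl
countF-cong {suc n} p≗q =
  ≡.cong₂ (λ b m → (if b then 1 else 0) ℕ.+ m) (p≗q Fin.zero) (countF-cong (p≗q ∘ Fin.suc))

countF-remove : ∀ {n} (p : Fin n → Bool) i → p i ≡ true →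
                countF p ≡ suc (countF (λ r → p r ∧ not (eqB r i)))
countF-remove {suc n} p Fin.zero p₀ rewrite p₀ =
  ≡.cong suc (countF-cong (λ r → ≡.sym (∧-identityʳ (p (Fin.suc r)))))
countF-remove {suc n} p (Fin.suc j) pᵢ
  rewrite countF-remove (p ∘ Fin.suc) j pᵢ
        | countF-cong (λ r → ≡.cong (λ b → p (Fin.suc r) ∧ not b) (eqB-suc r j))
  with p Fin.zero
... | true = ≡.refl
... | false = ≡.refl

module _ {n} (G : Graph n) where

  Twins : Fin n → Fin n → Set
  Twins u u' = ∀ z → adj G u z ≡ adj G u' z

  sameN⇒Twins : ∀ {u v} → sameN G u v ≡ true → Twins u v
  sameN⇒Twins {u} {v} same z = isYes⇒ (adj G u z Bool.≟ adj G v z) (allF-elim _ same z)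

  sameN-refl : ∀ u → sameN G u u ≡ true
  sameN-refl u = allF-intro _ (λ z → ⇒isYes (adj G u z Bool.≟ adj G u z) ≡.refl)

  Independent : (Fin n → Bool) → Set
  Independent p = ∀ x y → adj G x y ≡ true → p x ∧ p y ≡ false

  adj⇒≢ : ∀ {u v} → adj G u v ≡ true → u ≢ v
  adj⇒≢ {u} uv ≡.refl = true≢false (≡.trans (≡.sym uv) (adj-irr G u))

  twins-nonadjacent : ∀ {u v} → Twins u v → adj G u v ≡ false
  twins-nonadjacent {u} {v} tw = ≡.trans (tw v) (adj-irr G v)

  reach-refl : ∀ K k u → K u ≡ true → reach G K k u u ≡ true
  reach-refl K zero u Ku = ∧-true Ku (eqB-refl u)
  reach-refl K (suc k) u Ku = ∨-trueˡ _ (reach-refl K k u Ku)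

  reach-step : ∀ K k {u x v} → reach G K k u x ≡ true → adj G x v ≡ true → K v ≡ true →
               reach G K (suc k) u v ≡ true
  reach-step K k {x = x} ux xv Kv = ∨-trueʳ _ (anyF-intro _ x (∧-true ux (∧-true xv Kv)))

  reach-cases : ∀ K k {u v} → reach G K (suc k) u v ≡ true →
                reach G K k u v ≡ true ⊎ ∃ λ x → reach G K k u x ≡ true × adj G x v ≡ true
  reach-cases K k {u} {v} r with ∨-true (reach G K k u v) r
  ... | inj₁ uv = inj₁ uv
  ... | inj₂ any with anyF-witness _ any
  ...   | x , ux∧xvK = inj₂ (x , ∧-conicalˡ _ _ ux∧xvK , ∧-conicalˡ _ _ xvK)
    where
    xvK : adj G x v ∧ K v ≡ true
    xvK = ∧-conicalʳ (reach G K k u x) _ ux∧xvK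

  reach-allV : ∀ K k {u v} → reach G K k u v ≡ true → reach G allV k u v ≡ true
  reach-allV K zero r = ∧-conicalʳ _ _ r
  reach-allV K (suc k) r with reach-cases K k r
  ... | inj₁ uv = ∨-trueˡ _ (reach-allV K k uv)
  ... | inj₂ (x , ux , xv) = reach-step allV k (reach-allV K k ux) xv ≡.refl

  reach-twinsᵗ : ∀ {u u' v} → Twins u u' → v ≢ u → v ≢ u' →
                 ∀ k → reach G allV k v u ≡ reach G allV k v u'
  reach-twinsᵗ tw v≢u v≢u' zero = ≡.trans (eqB-false v≢u) (≡.sym (eqB-false v≢u'))
  reach-twinsᵗ {u} {u'} {v} tw v≢u v≢u' (suc k) =
    ≡.cong₂ _∨_ (reach-twinsᵗ tw v≢u v≢u' k) (anyF-cong (λ x →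
      ≡.cong (λ b → reach G allV k v x ∧ (b ∧ true))
           (≡.trans (adj-sym G x u) (≡.trans (tw x) (adj-sym G u' x)))))

  reach-twinsˢ : ∀ {u u'} → Twins u u' → ∀ k {v} → v ≢ u → v ≢ u' →
                 reach G allV k u v ≡ true → reach G allV k u' v ≡ true
  reach-twinsˢ tw zero v≢u _ r = ⊥-elim (v≢u (≡.sym (eqB-sound r)))
  reach-twinsˢ {u} {u'} tw (suc k) {v} v≢u v≢u' r with reach-cases allV k r
  ... | inj₁ uv = ∨-trueˡ _ (reach-twinsˢ tw k v≢u v≢u' uv)
  ... | inj₂ (x , ux , xv) with x ≟ u | x ≟ u'
  ...   | yes ≡.refl | _ =
    reach-step allV k (reach-refl allV k u' ≡.refl) (≡.trans (≡.sym (tw v)) xv) ≡.refl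
  ...   | no _ | yes ≡.refl = reach-step allV k (reach-refl allV k x ≡.refl) xv ≡.refl
  ...   | no x≢u | no x≢u' = reach-step allV k (reach-twinsˢ tw k x≢u x≢u' ux) xv ≡.refl

  reach-deleteTwins : ∀ K → (∀ x → K x ≡ false → ∃ λ t → K t ≡ true × Twins t x) →
                      ∀ k {u v} → K u ≡ true → K v ≡ true →
                      reach G allV k u v ≡ true → reach G K k u v ≡ true
  reach-deleteTwins K twin zero Ku Kv r = ∧-true Ku r
  reach-deleteTwins K twin (suc k) {u} {v} Ku Kv r with reach-cases allV k r
  ... | inj₁ uv = ∨-trueˡ _ (reach-deleteTwins K twin k Ku Kv uv)
  ... | inj₂ (x , ux , xv) with K x in Kx
  ...   | true = reach-step K k (reach-deleteTwins K twin k Ku Kx ux) xv Kv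
  ...   | false with twin x Kx
  ...     | t , Kt , tw = reach-step K k (reach-to-t (u ≟ t)) (≡.trans (tw v) xv) Kv
    where
    reach-to-t : Dec (u ≡ t) → reach G K k u t ≡ true
    reach-to-t (yes ≡.refl) = reach-refl K k u Ku
    reach-to-t (no u≢t) = reach-deleteTwins K twin k Ku Kt
      (≡.trans (reach-twinsᵗ tw u≢t (λ { ≡.refl → true≢false (≡.trans (≡.sym Ku) Kx) }) k) ux)

  distFrom-cong : ∀ {K K' u v u' v'} → (∀ k → reach G K k u v ≡ reach G K' k u' v') →
                  ∀ k fuel → distFrom G K u v k fuel ≡ distFrom G K' u' v' k fuel
  distFrom-cong same k zero = ≡.refl
  distFrom-cong same k (suc fuel) rewrite same k | distFrom-cong same (suc k) fuel = ≡.refl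

  dist-cong : ∀ {K K' u v u' v'} → (∀ k → reach G K k u v ≡ reach G K' k u' v') →
              dist G K u v ≡ dist G K' u' v'
  dist-cong same = distFrom-cong same 0 n

  distFrom-≥ : ∀ K u v k fuel → k ≤ distFrom G K u v k fuel
  distFrom-≥ K u v k zero = ≤-refl
  distFrom-≥ K u v k (suc fuel) with reach G K k u v
  ... | true = ≤-refl
  ... | false = <⇒≤ (distFrom-≥ K u v (suc k) fuel)

  distFrom-hit : ∀ {K u v k} fuel → reach G K k u v ≡ true → distFrom G K u v k (suc fuel) ≡ k
  distFrom-hit _ r rewrite r = ≡.refl

  distFrom-miss : ∀ {K u v k} fuel → reach G K k u v ≡ false →
                  distFrom G K u v k (suc fuel) ≡ distFrom G K u v (suc k) fuel
  distFrom-miss _ r rewrite r = ≡.refl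

dist-self : ∀ {n} (G : Graph n) K u → K u ≡ true → dist G K u u ≡ 0
dist-self {suc n} G K u Ku = distFrom-hit G n (reach-refl G K 0 u Ku)

dist-pos : ∀ {n} (G : Graph n) K {u v} → u ≢ v → 1 ≤ dist G K u v
dist-pos {suc n} G K {u} {v} u≢v =
  ≡.subst (1 ≤_) (≡.sym (distFrom-miss G n u↛v)) (distFrom-≥ G K u v 1 n)
  where
  u↛v : K u ∧ eqB u v ≡ false
  u↛v = ≡.trans (≡.cong (K u ∧_) (eqB-false u≢v)) (Bool.∧-zeroʳ (K u))

dist-adj : ∀ {n} (G : Graph n) {u v} → adj G u v ≡ true → dist G allV u v ≡ 1
dist-adj {suc zero} G {Fin.zero} {Fin.zero} uv = ⊥-elim (adj⇒≢ G uv ≡.refl)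
dist-adj {suc (suc n)} G {u} {v} uv =
  ≡.trans (distFrom-miss G {allV} {u} {v} {0} (suc n) (eqB-false (adj⇒≢ G uv)))
          (distFrom-hit G {allV} {u} {v} {1} n
            (reach-step G allV 0 (reach-refl G allV 0 u ≡.refl) uv ≡.refl))

module Sums {c ℓ : Level} (R : CommutativeSemiring c ℓ) where
  open CommutativeSemiring R
  open import Algebra.Properties.Semiring.Sum semiring
  open import Relation.Binary.Reasoning.Setoid setoid

  Σ≡sum : ∀ {n} (f : Fin n → Carrier) → Σ R f ≡ sum f
  Σ≡sum {zero} f = ≡.refl
  Σ≡sum {suc n} f = ≡.cong (f Fin.zero +_) (Σ≡sum (f ∘ Fin.suc))

  Σ-cong : ∀ {n} {f g : Fin n → Carrier} → (∀ i → f i ≈ g i) → Σ R f ≈ Σ R g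
  Σ-cong {f = f} {g} f≈g = begin
    Σ R f ≡⟨ Σ≡sum f ⟩
    sum f ≈⟨ sum-cong-≋ f≈g ⟩
    sum g ≡⟨ Σ≡sum g ⟨
    Σ R g ∎

  Σ-zero : ∀ n → Σ R {n} (λ _ → 0#) ≈ 0#
  Σ-zero n = trans (reflexive (Σ≡sum {n} (λ _ → 0#))) (sum-replicate-zero n)

  Σ-distrib-+ : ∀ {n} (f g : Fin n → Carrier) →
                Σ R (λ i → f i + g i) ≈ Σ R f + Σ R g
  Σ-distrib-+ f g = begin
    Σ R (λ i → f i + g i) ≡⟨ Σ≡sum (λ i → f i + g i) ⟩
    sum (λ i → f i + g i) ≈⟨ ∑-distrib-+ f g ⟩
    sum f + sum g         ≡⟨ ≡.cong₂ _+_ (Σ≡sum f) (Σ≡sum g) ⟨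
    Σ R f + Σ R g         ∎

  *-distribˡ-Σ : ∀ {n} a (f : Fin n → Carrier) → a * Σ R f ≈ Σ R (λ i → a * f i)
  *-distribˡ-Σ a f = begin
    a * Σ R f             ≡⟨ ≡.cong (a *_) (Σ≡sum f) ⟩
    a * sum f             ≈⟨ *-distribˡ-sum a f ⟩
    sum (λ i → a * f i)   ≡⟨ Σ≡sum (λ i → a * f i) ⟨
    Σ R (λ i → a * f i)   ∎

  *-distribʳ-Σ : ∀ {n} a (f : Fin n → Carrier) → Σ R f * a ≈ Σ R (λ i → f i * a)
  *-distribʳ-Σ a f = begin
    Σ R f * a             ≡⟨ ≡.cong (_* a) (Σ≡sum f) ⟩
    sum f * a             ≈⟨ *-distribʳ-sum a f ⟩
    sum (λ i → f i * a)   ≡⟨ Σ≡sum (λ i → f i * a) ⟨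
    Σ R (λ i → f i * a)   ∎

  Σ-comm : ∀ {m n} (f : Fin m → Fin n → Carrier) →
           Σ R (λ i → Σ R (λ j → f i j)) ≈ Σ R (λ j → Σ R (λ i → f i j))
  Σ-comm f = begin
    Σ R (λ i → Σ R (λ j → f i j)) ≡⟨ Σ²≡sum² f ⟩
    sum (λ i → sum (λ j → f i j)) ≈⟨ ∑-comm f ⟩
    sum (λ j → sum (λ i → f i j)) ≡⟨ Σ²≡sum² (λ j i → f i j) ⟨
    Σ R (λ j → Σ R (λ i → f i j)) ∎
    where
    Σ²≡sum² : ∀ {m n} (g : Fin m → Fin n → Carrier) →
              Σ R (λ i → Σ R (g i)) ≡ sum (λ i → sum (g i))
    Σ²≡sum² g = ≡.trans (Σ≡sum (λ i → Σ R (g i))) (sum-cong-≗ (λ i → Σ≡sum (g i)))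

  ind-∧ : ∀ a b x → ind R (a ∧ b) x ≡ ind R a (ind R b x)
  ind-∧ true b x = ≡.refl
  ind-∧ false b x = ≡.refl

  ind-comm : ∀ a b x → ind R a (ind R b x) ≡ ind R b (ind R a x)
  ind-comm true b x = ≡.refl
  ind-comm false true x = ≡.refl
  ind-comm false false x = ≡.refl

  ind-cong : ∀ b {x y} → (b ≡ true → x ≈ y) → ind R b x ≈ ind R b y
  ind-cong true x≈y = x≈y ≡.refl
  ind-cong false x≈y = refl

  ind-zero : ∀ b → ind R b 0# ≈ 0#
  ind-zero true = refl
  ind-zero false = refl

  *-distribˡ-ind : ∀ a b x → a * ind R b x ≈ ind R b (a * x)
  *-distribˡ-ind a true x = refl
  *-distribˡ-ind a false x = zeroʳ a

  *-distribʳ-ind : ∀ a b x → ind R b x * a ≈ ind R b (x * a)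
  *-distribʳ-ind a true x = refl
  *-distribʳ-ind a false x = zeroˡ a

  ind-distrib-+ : ∀ b x y → ind R b (x + y) ≈ ind R b x + ind R b y
  ind-distrib-+ true x y = refl
  ind-distrib-+ false x y = sym (+-identityˡ 0#)

  ind-distrib-Σ : ∀ {n} b (f : Fin n → Carrier) → ind R b (Σ R f) ≈ Σ R (λ i → ind R b (f i))
  ind-distrib-Σ true f = refl
  ind-distrib-Σ {n} false f = sym (Σ-zero n)

  ind-+-ind-not : ∀ b x → ind R b x + ind R (not b) x ≈ x
  ind-+-ind-not true x = +-identityʳ x
  ind-+-ind-not false x = +-identityˡ x

  Σ-ind-≡ : ∀ {n} (f : Fin n → Carrier) j → Σ R (λ i → ind R (eqB i j) (f i)) ≈ f j
  Σ-ind-≡ {suc n} f Fin.zero = trans (+-congˡ (Σ-zero n)) (+-identityʳ _)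
  Σ-ind-≡ {suc n} f (Fin.suc j) = begin
    0# + Σ R (λ i → ind R (eqB (Fin.suc i) (Fin.suc j)) (f (Fin.suc i)))
      ≈⟨ +-identityˡ _ ⟩
    Σ R (λ i → ind R (eqB (Fin.suc i) (Fin.suc j)) (f (Fin.suc i)))
      ≈⟨ Σ-cong (λ i → reflexive (≡.cong (λ b → ind R b (f (Fin.suc i))) (eqB-suc i j))) ⟩
    Σ R (λ i → ind R (eqB i j) (f (Fin.suc i)))
      ≈⟨ Σ-ind-≡ (f ∘ Fin.suc) j ⟩
    f (Fin.suc j) ∎

  Σ-ind-const : ∀ {n} (p : Fin n → Bool) a → Σ R (λ i → ind R (p i) a) ≈ fromℕ R (countF p) * a
  Σ-ind-const {zero} p a = sym (zeroˡ a)
  Σ-ind-const {suc n} p a with p Fin.zero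
  ... | true = trans (+-cong (sym (*-identityˡ a)) (Σ-ind-const (p ∘ Fin.suc) a))
                     (sym (distribʳ a 1# _))
  ... | false = trans (+-identityˡ _) (Σ-ind-const (p ∘ Fin.suc) a)

  Σ²-distrib-+ : ∀ {m n} (f g : Fin m → Fin n → Carrier) →
                 Σ R (λ i → Σ R (λ j → f i j + g i j)) ≈
                 Σ R (λ i → Σ R (f i)) + Σ R (λ i → Σ R (g i))
  Σ²-distrib-+ f g = trans (Σ-cong (λ i → Σ-distrib-+ (f i) (g i)))
                           (Σ-distrib-+ (λ i → Σ R (f i)) (λ i → Σ R (g i)))

  *-distribˡ-Σ² : ∀ {m n} a (f : Fin m → Fin n → Carrier) →
                  a * Σ R (λ i → Σ R (f i)) ≈ Σ R (λ i → Σ R (λ j → a * f i j))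
  *-distribˡ-Σ² a f = trans (*-distribˡ-Σ a (λ i → Σ R (f i))) (Σ-cong (λ i → *-distribˡ-Σ a (f i)))

  Σ-ind-comm : ∀ {m n} (a : Fin m → Bool) (b : Fin n → Bool) (g : Fin m → Fin n → Carrier) →
    Σ R (λ i → ind R (a i) (Σ R (λ j → ind R (b j) (g i j)))) ≈
    Σ R (λ j → ind R (b j) (Σ R (λ i → ind R (a i) (g i j))))
  Σ-ind-comm a b g = begin
    Σ R (λ i → ind R (a i) (Σ R (λ j → ind R (b j) (g i j))))
      ≈⟨ Σ-cong (λ i → ind-distrib-Σ (a i) (λ j → ind R (b j) (g i j))) ⟩
    Σ R (λ i → Σ R (λ j → ind R (a i) (ind R (b j) (g i j))))
      ≈⟨ Σ-comm (λ i j → ind R (a i) (ind R (b j) (g i j))) ⟩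
    Σ R (λ j → Σ R (λ i → ind R (a i) (ind R (b j) (g i j))))
      ≈⟨ Σ-cong (λ j → Σ-cong (λ i → reflexive (ind-comm (a i) (b j) (g i j)))) ⟩
    Σ R (λ j → Σ R (λ i → ind R (b j) (ind R (a i) (g i j))))
      ≈⟨ Σ-cong (λ j → sym (ind-distrib-Σ (b j) (λ i → ind R (a i) (g i j)))) ⟩
    Σ R (λ j → ind R (b j) (Σ R (λ i → ind R (a i) (g i j)))) ∎

module EdgeSums {c ℓ : Level} (R : CommutativeSemiring c ℓ) {n : ℕ} (G : Graph n) where
  open CommutativeSemiring R
  open Sums R
  open import Relation.Binary.Reasoning.Setoid setoid

  adjK : (Fin n → Bool) → Fin n → Fin n → Bool
  adjK K x y = adj G x y ∧ (K x ∧ K y)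

  adjK-sym : ∀ K x y → adjK K x y ≡ adjK K y x
  adjK-sym K x y = ≡.cong₂ _∧_ (adj-sym G x y) (∧-comm (K x) (K y))

  ind-ltB-+-ind-ltB : ∀ {x y : Fin n} → x ≢ y → ∀ u → ind R (ltB x y) u + ind R (ltB y x) u ≈ u
  ind-ltB-+-ind-ltB {x} {y} x≢y u =
    trans (+-congˡ (reflexive (≡.cong (λ b → ind R b u) (ltB-flip x≢y))))
          (ind-+-ind-not (ltB x y) u)

  edgeSum : (Fin n → Bool) → (Fin n → Fin n → Carrier) → Carrier
  edgeSum K F = Σ R (λ x → Σ R (λ y → ind R (isEdge G K x y) (F x y)))

  ind-split-independent : ∀ e px py u → (e ≡ true → px ∧ py ≡ false) →
    ind R e u ≈ ind R (not px ∧ not py) (ind R e u) + (ind R e (ind R px u) + ind R e (ind R py u))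
  ind-split-independent e false false u _ =
    sym (trans (+-congˡ (trans (+-cong (ind-zero e) (ind-zero e)) (+-identityʳ 0#)))
               (+-identityʳ _))
  ind-split-independent e true false u _ =
    sym (trans (+-identityˡ _) (trans (+-congˡ (ind-zero e)) (+-identityʳ _)))
  ind-split-independent e false true u _ =
    sym (trans (+-identityˡ _) (trans (+-congʳ (ind-zero e)) (+-identityˡ _)))
  ind-split-independent false true true u _ = sym (trans (+-identityˡ _) (+-identityˡ 0#))
  ind-split-independent true true true u both = ⊥-elim (true≢false (both ≡.refl))

  ind-edge-merge : ∀ K x y {U U'} → U' ≈ U →
    ind R (isEdge G K x y) U + ind R (isEdge G K y x) U' ≈ ind R (adjK K x y) U
  ind-edge-merge K x y {U} {U'} U'≈U = begin
    ind R (isEdge G K x y) U + ind R (isEdge G K y x) U'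
      ≡⟨ ≡.cong₂ _+_ (ind-∧ (ltB x y) (adjK K x y) U)
                     (≡.trans (≡.cong (λ b → ind R (ltB y x ∧ b) U') (adjK-sym K y x))
                              (ind-∧ (ltB y x) (adjK K x y) U')) ⟩
    ind R (ltB x y) (ind R (adjK K x y) U) + ind R (ltB y x) (ind R (adjK K x y) U')
      ≈⟨ merge (adjK K x y) ≡.refl ⟩
    ind R (adjK K x y) U ∎
    where
    merge : ∀ a → a ≡ adjK K x y →
            ind R (ltB x y) (ind R a U) + ind R (ltB y x) (ind R a U') ≈ ind R a U
    merge false _ = trans (+-cong (ind-zero (ltB x y)) (ind-zero (ltB y x))) (+-identityʳ 0#)
    merge true a≡adjK = trans (+-congˡ (ind-cong (ltB y x) (λ _ → U'≈U)))
      (ind-ltB-+-ind-ltB (adj⇒≢ G (∧-conicalˡ _ _ (≡.sym a≡adjK))) U)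

  avoiding : (Fin n → Bool) → (Fin n → Bool) → (Fin n → Fin n → Carrier) → Carrier
  avoiding p K F =
    Σ R (λ x → Σ R (λ y → ind R (not (p x) ∧ not (p y)) (ind R (isEdge G K x y) (F x y))))

  incident : (Fin n → Bool) → (Fin n → Bool) → (Fin n → Fin n → Carrier) → Carrier
  incident p K F = Σ R (λ x → Σ R (λ y → ind R (adjK K x y) (ind R (p x) (F x y))))

  -- No edge has both ends in p; an edge with one end in p is recounted, by symmetry of
  -- F, as the ordered pair with the p-end first.
  edgeSum-split : ∀ {p} → Independent G p → ∀ K (F : Fin n → Fin n → Carrier) →
    (∀ x y → F x y ≈ F y x) → edgeSum K F ≈ avoiding p K F + incident p K F
  edgeSum-split {p} indep K F F-sym = begin
    edgeSum K F
      ≈⟨ Σ-cong (λ x → Σ-cong (λ y → ind-split-independent (isEdge G K x y) (p x) (p y) (F x y)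
           (λ e → indep x y (∧-conicalˡ _ _ (∧-conicalʳ (ltB x y) _ e))))) ⟩
    Σ R (λ x → Σ R (λ y → avoid x y + (fromˡ x y + fromʳ x y)))
      ≈⟨ Σ²-distrib-+ avoid (λ x y → fromˡ x y + fromʳ x y) ⟩
    avoiding p K F + Σ R (λ x → Σ R (λ y → fromˡ x y + fromʳ x y))
      ≈⟨ +-congˡ (trans (Σ²-distrib-+ fromˡ fromʳ) (+-congˡ (Σ-comm fromʳ))) ⟩
    avoiding p K F + (Σ² fromˡ + Σ² (λ y x → fromʳ x y))
      ≈⟨ +-congˡ (sym (Σ²-distrib-+ fromˡ (λ y x → fromʳ x y))) ⟩
    avoiding p K F + Σ R (λ x → Σ R (λ y → fromˡ x y + fromʳ y x))
      ≈⟨ +-congˡ (Σ-cong (λ x → Σ-cong (λ y →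
           ind-edge-merge K x y (ind-cong (p x) (λ _ → F-sym y x))))) ⟩
    avoiding p K F + incident p K F ∎
    where
    Σ² : (Fin n → Fin n → Carrier) → Carrier
    Σ² f = Σ R (λ x → Σ R (f x))
    avoid fromˡ fromʳ : Fin n → Fin n → Carrier
    avoid x y = ind R (not (p x) ∧ not (p y)) (ind R (isEdge G K x y) (F x y))
    fromˡ x y = ind R (isEdge G K x y) (ind R (p x) (F x y))
    fromʳ x y = ind R (isEdge G K x y) (ind R (p y) (F x y))

  distToEdge : (Fin n → Bool) → Fin n → Fin n → Fin n → ℕ
  distToEdge K v x y = dist G K v x ⊓ dist G K v y

  contribution : (Fin n → Bool) → (Fin n → Fin n → Carrier) → Fin n → Fin n → Fin n → Carrier
  contribution K we v x y = ew R we x y * fromℕ R (distToEdge K v x y)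

  contribution-sym : ∀ K we v x y → contribution K we v x y ≈ contribution K we v y x
  contribution-sym K we v x y = reflexive (≡.cong₂ (λ e d → e * fromℕ R d)
    (minF-maxF-comm we x y) (⊓-comm (dist G K v x) (dist G K v y)))

  Wve-factor : ∀ K w we →
    Wve R G K w we ≈ Σ R (λ v → ind R (K v) (w v * edgeSum K (contribution K we v)))
  Wve-factor K w we = Σ-cong (λ v → ind-cong (K v) (λ _ → begin
    Σ R (λ x → Σ R (λ y → ind R (isEdge G K x y) ((w v * ew R we x y) * d v x y)))
      ≈⟨ Σ-cong (λ x → Σ-cong (λ y → trans (ind-cong (isEdge G K x y) (λ _ → *-assoc _ _ _))
                                           (sym (*-distribˡ-ind (w v) _ _)))) ⟩
    Σ R (λ x → Σ R (λ y → w v * ind R (isEdge G K x y) (contribution K we v x y)))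
      ≈⟨ sym (*-distribˡ-Σ² (w v) (λ x y → ind R (isEdge G K x y) (contribution K we v x y))) ⟩
    w v * edgeSum K (contribution K we v) ∎))
    where
    d : Fin n → Fin n → Fin n → Carrier
    d v x y = fromℕ R (distToEdge K v x y)

  Wve-split : ∀ {p} → Independent G p → ∀ K w we →
    Wve R G K w we ≈ Σ R (λ v → ind R (K v)
      (w v * (avoiding p K (contribution K we v) + incident p K (contribution K we v))))
  Wve-split indep K w we = trans (Wve-factor K w we) (Σ-cong (λ v → ind-cong (K v) (λ _ →
    *-congˡ (edgeSum-split indep K (contribution K we v) (contribution-sym K we v)))))

module TwinClass {n : ℕ} (G : Graph n) (c₀ : Fin n) where

  C : Fin n → Bool
  C v = sameN G v c₀

  K' : Fin n → Bool
  K' v = not (C v) ∨ eqB v c₀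

  C⇒Twins : ∀ {x} → C x ≡ true → Twins G x c₀
  C⇒Twins = sameN⇒Twins G

  C-c₀ : C c₀ ≡ true
  C-c₀ = sameN-refl G c₀

  C-neighbour : ∀ {x y} → adj G x y ≡ true → C x ≡ true → C y ≡ false
  C-neighbour {x} {y} xy Cx with C y in Cy
  ... | false = ≡.refl
  ... | true = ⊥-elim (true≢false (≡.trans (≡.sym xy) (twins-nonadjacent G x~y)))
    where
    x~y : Twins G x y
    x~y z = ≡.trans (C⇒Twins Cx z) (≡.sym (C⇒Twins Cy z))

  C≢ : ∀ {x y} → C x ≡ false → C y ≡ true → x ≢ y
  C≢ Cx Cy ≡.refl = true≢false (≡.trans (≡.sym Cy) Cx)

  K'-notC : ∀ {x} → C x ≡ false → K' x ≡ true
  K'-notC Cx rewrite Cx = ≡.refl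

  K'-c₀ : K' c₀ ≡ true
  K'-c₀ rewrite C-c₀ = eqB-refl c₀

  dist-K' : ∀ {u v} → K' u ≡ true → K' v ≡ true → dist G K' u v ≡ dist G allV u v
  dist-K' K'u K'v = dist-cong G (λ k → ⇔→≡ {z = true} (mk⇔ (reach-allV G K' k)
    (reach-deleteTwins G K' c₀-twin k K'u K'v)))
    where
    c₀-twin : ∀ x → K' x ≡ false → ∃ λ t → K' t ≡ true × Twins G t x
    c₀-twin x K'x with C x in Cx
    ... | true = c₀ , K'-c₀ , λ z → ≡.sym (C⇒Twins Cx z)
    ... | false = ⊥-elim (true≢false K'x)

  dist-C-source : ∀ {v x} → C v ≡ true → C x ≡ false → dist G allV v x ≡ dist G allV c₀ x
  dist-C-source Cv Cx = dist-cong G (λ k → ⇔→≡ {z = true} (mk⇔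
    (reach-twinsˢ G (C⇒Twins Cv) k (C≢ Cx Cv) (C≢ Cx C-c₀))
    (reach-twinsˢ G (λ z → ≡.sym (C⇒Twins Cv z)) k (C≢ Cx C-c₀) (C≢ Cx Cv))))

  dist-C-target : ∀ {v r} → C v ≡ false → C r ≡ true → dist G allV v r ≡ dist G allV v c₀
  dist-C-target Cv Cr = dist-cong G (reach-twinsᵗ G (C⇒Twins Cr) (C≢ Cv Cr) (C≢ Cv C-c₀))

  dist-twin-edge : ∀ {i r m} → C i ≡ true → C r ≡ true → i ≢ r → adj G r m ≡ true →
                   dist G allV i r ⊓ dist G allV i m ≡ 1
  dist-twin-edge {i} {r} {m} Ci Cr i≢r rm = begin
    dist G allV i r ⊓ dist G allV i m ≡⟨ ≡.cong (dist G allV i r ⊓_) (dist-adj G im) ⟩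
    dist G allV i r ⊓ 1               ≡⟨ m≥n⇒m⊓n≡n (dist-pos G allV i≢r) ⟩
    1                                 ∎
    where
    open ≡.≡-Reasoning
    im : adj G i m ≡ true
    im = ≡.trans (C⇒Twins Ci m) (≡.trans (≡.sym (C⇒Twins Cr m)) rm)

  isEdge-K' : ∀ {x y} → C x ≡ false → C y ≡ false → isEdge G K' x y ≡ isEdge G allV x y
  isEdge-K' {x} {y} Cx Cy =
    ≡.cong₂ (λ a b → ltB x y ∧ (adj G x y ∧ (a ∧ b))) (K'-notC Cx) (K'-notC Cy)

module Reduction {c ℓ : Level} (R : CommutativeSemiring c ℓ) {n : ℕ} (G : Graph n) (c₀ : Fin n)
  (w w' : Fin n → CommutativeSemiring.Carrier R)
  (we we' : Fin n → Fin n → CommutativeSemiring.Carrier R) where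
  open CommutativeSemiring R
  open Sums R
  open EdgeSums R G
  open TwinClass G c₀
  open import Relation.Binary.Reasoning.Setoid setoid

  C-independent : Independent G C
  C-independent x y xy with C x in Cx
  ... | true = C-neighbour xy Cx
  ... | false = ≡.refl

  k s : ℕ
  k = countF C
  s = countF (adj G c₀)

  F F' : Fin n → Fin n → Fin n → Carrier
  F = contribution allV we
  F' = contribution K' we'

  incident-allV : ∀ f →
    incident C allV f ≈ Σ R (λ r → ind R (C r) (Σ R (λ m → ind R (adj G r m) (f r m))))
  incident-allV f = Σ-cong (λ r → begin
    Σ R (λ m → ind R (adj G r m ∧ true) (ind R (C r) (f r m)))
      ≈⟨ Σ-cong (λ m → reflexive (≡.trans
           (≡.cong (λ b → ind R b (ind R (C r) (f r m))) (∧-identityʳ (adj G r m)))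
           (ind-comm (adj G r m) (C r) (f r m)))) ⟩
    Σ R (λ m → ind R (C r) (ind R (adj G r m) (f r m)))
      ≈⟨ ind-distrib-Σ (C r) (λ m → ind R (adj G r m) (f r m)) ⟨
    ind R (C r) (Σ R (λ m → ind R (adj G r m) (f r m))) ∎)

  incident-K' : ∀ f → incident C K' f ≈ Σ R (λ m → ind R (adj G c₀ m) (f c₀ m))
  incident-K' f = begin
    incident C K' f
      ≈⟨ Σ-cong (λ x → Σ-cong (λ y → term x y (f x y))) ⟩
    Σ R (λ x → Σ R (λ y → ind R (eqB x c₀) (ind R (adj G x y) (f x y))))
      ≈⟨ Σ-cong (λ x → ind-distrib-Σ (eqB x c₀) (λ y → ind R (adj G x y) (f x y))) ⟨
    Σ R (λ x → ind R (eqB x c₀) (Σ R (λ y → ind R (adj G x y) (f x y))))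
      ≈⟨ Σ-ind-≡ (λ x → Σ R (λ y → ind R (adj G x y) (f x y))) c₀ ⟩
    Σ R (λ m → ind R (adj G c₀ m) (f c₀ m)) ∎
    where
    term : ∀ x y u → ind R (adj G x y ∧ (K' x ∧ K' y)) (ind R (C x) u) ≈
                     ind R (eqB x c₀) (ind R (adj G x y) u)
    term x y u with adj G x y in xy | C x in Cx
    ... | false | _ = sym (ind-zero (eqB x c₀))
    ... | true | false = trans (ind-zero _)
      (reflexive (≡.cong (λ b → ind R b u) (≡.sym (eqB-false (C≢ Cx C-c₀)))))
    ... | true | true = reflexive (≡.cong (λ b → ind R b u)
      (≡.trans (≡.cong (eqB x c₀ ∧_) (K'-notC (C-neighbour xy Cx))) (∧-identityʳ (eqB x c₀))))

  incident-c₀ : Σ R (λ m → ind R (adj G c₀ m) (F' c₀ c₀ m)) ≈ 0#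
  incident-c₀ = trans (Σ-cong (λ m → trans (ind-cong (adj G c₀ m) (λ _ → trans
      (*-congˡ (reflexive (≡.cong (λ d → fromℕ R (d ⊓ dist G K' c₀ m)) (dist-self G K' c₀ K'-c₀))))
      (zeroʳ _))) (ind-zero (adj G c₀ m))))
    (Σ-zero n)

  incident-inside : ∀ {i} → C i ≡ true →
    w i * Σ R (λ r → ind R (C r) (Σ R (λ m → ind R (adj G r m) (F i r m)))) ≈
    Σ R (λ r → ind R (C r ∧ not (eqB r i)) (Σ R (λ m → ind R (adj G r m) (w i * ew R we r m))))
  incident-inside {i} Ci = trans (*-distribˡ-Σ (w i) (λ r → ind R (C r) (S r))) (Σ-cong (λ r → begin
    w i * ind R (C r) (Σ R (λ m → ind R (adj G r m) (F i r m)))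
      ≈⟨ *-distribˡ-ind (w i) (C r) _ ⟩
    ind R (C r) (w i * Σ R (λ m → ind R (adj G r m) (F i r m)))
      ≈⟨ ind-cong (C r) (term r) ⟩
    ind R (C r) (ind R (not (eqB r i)) (Σ R (λ m → ind R (adj G r m) (w i * ew R we r m))))
      ≡⟨ ind-∧ (C r) (not (eqB r i)) _ ⟨
    ind R (C r ∧ not (eqB r i)) (Σ R (λ m → ind R (adj G r m) (w i * ew R we r m))) ∎))
    where
    S : Fin n → Carrier
    S r = Σ R (λ m → ind R (adj G r m) (F i r m))
    term : ∀ r → C r ≡ true →
      w i * Σ R (λ m → ind R (adj G r m) (F i r m)) ≈
      ind R (not (eqB r i)) (Σ R (λ m → ind R (adj G r m) (w i * ew R we r m)))
    term r Cr with eqB r i in r≟i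
    ... | true rewrite eqB-sound r≟i = trans (*-congˡ (trans (Σ-cong (λ m →
          trans (ind-cong (adj G i m) (λ _ → trans (*-congˡ (reflexive
                  (≡.cong (λ d → fromℕ R (d ⊓ dist G allV i m)) (dist-self G allV i ≡.refl))))
                  (zeroʳ _)))
                (ind-zero (adj G i m)))) (Σ-zero n))) (zeroʳ (w i))
    ... | false = trans (*-distribˡ-Σ (w i) (λ m → ind R (adj G r m) (F i r m))) (Σ-cong (λ m →
          trans (*-distribˡ-ind (w i) (adj G r m) _) (ind-cong (adj G r m) (λ rm → *-congˡ
            (trans (*-congˡ (trans (reflexive (≡.cong (fromℕ R) (dist-twin-edge Ci Cr i≢r rm)))
                                   (+-identityʳ 1#)))
                   (*-identityʳ _))))))
      where
      i≢r : i ≢ r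
      i≢r ≡.refl = true≢false (≡.trans (≡.sym (eqB-refl i)) r≟i)

  Σ-over-K' : ∀ g → Σ R (λ v → ind R (K' v) (g v)) ≈ Σ R (λ v → ind R (not (C v)) (g v)) + g c₀
  Σ-over-K' g = begin
    Σ R (λ v → ind R (K' v) (g v))
      ≈⟨ Σ-cong split ⟩
    Σ R (λ v → ind R (not (C v)) (g v) + ind R (eqB v c₀) (g v))
      ≈⟨ Σ-distrib-+ (λ v → ind R (not (C v)) (g v)) (λ v → ind R (eqB v c₀) (g v)) ⟩
    Σ R (λ v → ind R (not (C v)) (g v)) + Σ R (λ v → ind R (eqB v c₀) (g v))
      ≈⟨ +-congˡ (Σ-ind-≡ g c₀) ⟩
    Σ R (λ v → ind R (not (C v)) (g v)) + g c₀ ∎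
    where
    split : ∀ v → ind R (K' v) (g v) ≈ ind R (not (C v)) (g v) + ind R (eqB v c₀) (g v)
    split v with C v in Cv
    ... | true = sym (+-identityˡ _)
    ... | false rewrite eqB-false (C≢ Cv C-c₀) = sym (+-identityʳ (g v))

  excess : Carrier
  excess = Σ R (λ i → ind R (C i) (Σ R (λ r → ind R (C r ∧ not (eqB r i))
             (Σ R (λ m → ind R (adj G r m) (w i * ew R we r m))))))

  excess-homogeneous : ∀ a b → (∀ i → C i ≡ true → w i ≈ a) →
    (∀ r m → C r ≡ true → adj G r m ≡ true → ew R we r m ≈ b) →
    excess ≈ (((a * b) * fromℕ R k) * fromℕ R (k ∸ 1)) * fromℕ R s
  excess-homogeneous a b w≈a we≈b = begin
    excess
      ≈⟨ Σ-cong (λ i → ind-cong (C i) (others i)) ⟩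
    Σ R (λ i → ind R (C i) (fromℕ R (k ∸ 1) * (fromℕ R s * (a * b))))
      ≈⟨ Σ-ind-const C _ ⟩
    fromℕ R k * (fromℕ R (k ∸ 1) * (fromℕ R s * (a * b)))
      ≈⟨ solve 5 (λ a b k k-1 s → k ⊕ (k-1 ⊕ (s ⊕ (a ⊕ b))) ⊜ (((a ⊕ b) ⊕ k) ⊕ k-1) ⊕ s)
               refl a b (fromℕ R k) (fromℕ R (k ∸ 1)) (fromℕ R s) ⟩
    (((a * b) * fromℕ R k) * fromℕ R (k ∸ 1)) * fromℕ R s ∎
    where
    open import Algebra.Solver.CommutativeMonoid *-commutativeMonoid
    edges : ∀ i r → C i ≡ true → C r ≡ true →
            Σ R (λ m → ind R (adj G r m) (w i * ew R we r m)) ≈ fromℕ R s * (a * b)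
    edges i r Ci Cr = trans (Σ-cong (λ m → trans
        (reflexive (≡.cong (λ e → ind R e (w i * ew R we r m)) (C⇒Twins Cr m)))
        (ind-cong (adj G c₀ m) (λ c₀m → *-cong (w≈a i Ci)
          (we≈b r m Cr (≡.trans (C⇒Twins Cr m) c₀m))))))
      (Σ-ind-const (adj G c₀) (a * b))
    others : ∀ i → C i ≡ true →
             Σ R (λ r → ind R (C r ∧ not (eqB r i))
               (Σ R (λ m → ind R (adj G r m) (w i * ew R we r m)))) ≈
             fromℕ R (k ∸ 1) * (fromℕ R s * (a * b))
    others i Ci = begin
      Σ R (λ r → ind R (C r ∧ not (eqB r i)) (Σ R (λ m → ind R (adj G r m) (w i * ew R we r m))))
        ≈⟨ Σ-cong (λ r → ind-cong (C r ∧ not (eqB r i)) (λ e → edges i r Ci (∧-conicalˡ _ _ e))) ⟩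
      Σ R (λ r → ind R (C r ∧ not (eqB r i)) (fromℕ R s * (a * b)))
        ≈⟨ Σ-ind-const (λ r → C r ∧ not (eqB r i)) _ ⟩
      fromℕ R (countF (λ r → C r ∧ not (eqB r i))) * (fromℕ R s * (a * b))
        ≡⟨ ≡.cong (λ m → fromℕ R (m ∸ 1) * (fromℕ R s * (a * b))) (countF-remove C i Ci) ⟨
      fromℕ R (k ∸ 1) * (fromℕ R s * (a * b)) ∎

  before after : Fin n → Carrier
  before v = w v * (avoiding C allV (F v) + incident C allV (F v))
  after v = w' v * (avoiding C K' (F' v) + incident C K' (F' v))

  module _ (w'-c₀ : w' c₀ ≈ Σ R (λ i → ind R (C i) (w i)))
           (w'-out : ∀ v → C v ≡ false → w' v ≈ w v)
           (we'-c₀ : ∀ m → adj G c₀ m ≡ true →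
                       ew R we' c₀ m ≈ Σ R (λ i → ind R (C i) (ew R we i m)))
           (we'-out : ∀ x y → adj G x y ≡ true → C x ≡ false → C y ≡ false →
                        ew R we' x y ≈ ew R we x y)
           where

    avoiding-reduce : ∀ v u → (∀ x → C x ≡ false → dist G K' u x ≡ dist G allV v x) →
      avoiding C allV (F v) ≈ avoiding C K' (F' u)
    avoiding-reduce v u same-dist =
      Σ-cong (λ x → Σ-cong (λ y → ind-cong (not (C x) ∧ not (C y)) (term x y)))
      where
      term : ∀ x y → not (C x) ∧ not (C y) ≡ true →
             ind R (isEdge G allV x y) (F v x y) ≈ ind R (isEdge G K' x y) (F' u x y)
      term x y outside = begin
        ind R (isEdge G allV x y) (F v x y)
          ≈⟨ ind-cong (isEdge G allV x y) (λ e → *-cong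
               (sym (we'-out x y (∧-conicalˡ _ _ (∧-conicalʳ (ltB x y) _ e)) Cx Cy))
               (reflexive (≡.cong (fromℕ R)
                 (≡.sym (≡.cong₂ _⊓_ (same-dist x Cx) (same-dist y Cy)))))) ⟩
        ind R (isEdge G allV x y) (F' u x y)
          ≡⟨ ≡.cong (λ e → ind R e (F' u x y)) (isEdge-K' Cx Cy) ⟨
        ind R (isEdge G K' x y) (F' u x y) ∎
        where
        Cx : C x ≡ false
        Cx = not-injective (∧-conicalˡ _ _ outside)
        Cy : C y ≡ false
        Cy = not-injective (∧-conicalʳ (not (C x)) _ outside)

    incident-outside : ∀ {v} → C v ≡ false →
      Σ R (λ r → ind R (C r) (Σ R (λ m → ind R (adj G r m) (F v r m)))) ≈
      Σ R (λ m → ind R (adj G c₀ m) (F' v c₀ m))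
    incident-outside {v} Cv = begin
      Σ R (λ r → ind R (C r) (Σ R (λ m → ind R (adj G r m) (F v r m))))
        ≈⟨ Σ-cong (λ r → ind-cong (C r) (λ Cr → Σ-cong (λ m → trans
             (reflexive (≡.cong (λ b → ind R b (F v r m)) (C⇒Twins Cr m)))
             (ind-cong (adj G c₀ m) (λ _ → *-congˡ (reflexive (≡.cong (λ d → fromℕ R (d ⊓ _))
               (dist-C-target Cv Cr)))))))) ⟩
      Σ R (λ r → ind R (C r) (Σ R (λ m → ind R (adj G c₀ m) (ew R we r m * D m))))
        ≈⟨ Σ-ind-comm C (adj G c₀) (λ r m → ew R we r m * D m) ⟩
      Σ R (λ m → ind R (adj G c₀ m) (Σ R (λ r → ind R (C r) (ew R we r m * D m))))
        ≈⟨ Σ-cong (λ m → ind-cong (adj G c₀ m) (λ c₀m → begin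
             Σ R (λ r → ind R (C r) (ew R we r m * D m))
               ≈⟨ Σ-cong (λ r → *-distribʳ-ind (D m) (C r) (ew R we r m)) ⟨
             Σ R (λ r → ind R (C r) (ew R we r m) * D m)
               ≈⟨ *-distribʳ-Σ (D m) (λ r → ind R (C r) (ew R we r m)) ⟨
             Σ R (λ r → ind R (C r) (ew R we r m)) * D m
               ≈⟨ *-cong (sym (we'-c₀ m c₀m)) (reflexive (≡.cong₂ (λ d d' → fromℕ R (d ⊓ d'))
                    (≡.sym (dist-K' K'v K'-c₀))
                    (≡.sym (dist-K' K'v (K'-notC (C-neighbour c₀m C-c₀)))))) ⟩
             F' v c₀ m ∎)) ⟩
      Σ R (λ m → ind R (adj G c₀ m) (F' v c₀ m)) ∎
      where
      D : Fin n → Carrier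
      D m = fromℕ R (dist G allV v c₀ ⊓ dist G allV v m)
      K'v : K' v ≡ true
      K'v = K'-notC Cv

    outside-C : ∀ v → C v ≡ false → before v ≈ after v
    outside-C v Cv = *-cong (sym (w'-out v Cv)) (+-cong
      (avoiding-reduce v v (λ x Cx → dist-K' (K'-notC Cv) (K'-notC Cx)))
      (begin
        incident C allV (F v)                                              ≈⟨ incident-allV (F v) ⟩
        Σ R (λ r → ind R (C r) (Σ R (λ m → ind R (adj G r m) (F v r m))))  ≈⟨ incident-outside Cv ⟩
        Σ R (λ m → ind R (adj G c₀ m) (F' v c₀ m))                         ≈⟨ incident-K' (F' v) ⟨
        incident C K' (F' v)                                               ∎))

    inside-C : Σ R (λ v → ind R (C v) (before v)) ≈ after c₀ + excess
    inside-C = begin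
      Σ R (λ v → ind R (C v) (before v))
        ≈⟨ Σ-cong (λ v → trans (ind-cong (C v) (λ Cv → trans
             (*-congˡ (+-congʳ (avoiding-reduce v c₀ (λ x Cx →
               ≡.trans (dist-K' K'-c₀ (K'-notC Cx)) (≡.sym (dist-C-source Cv Cx))))))
             (distribˡ (w v) N₀ (incident C allV (F v)))))
             (ind-distrib-+ (C v) (w v * N₀) (w v * incident C allV (F v)))) ⟩
      Σ R (λ v → ind R (C v) (w v * N₀) + ind R (C v) (w v * incident C allV (F v)))
        ≈⟨ Σ-distrib-+ (λ v → ind R (C v) (w v * N₀))
                       (λ v → ind R (C v) (w v * incident C allV (F v))) ⟩
      Σ R (λ v → ind R (C v) (w v * N₀)) + Σ R (λ v → ind R (C v) (w v * incident C allV (F v)))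
        ≈⟨ +-cong merged-weight (Σ-cong (λ i → ind-cong (C i) (λ Ci →
             trans (*-congˡ (incident-allV (F i))) (incident-inside Ci)))) ⟩
      w' c₀ * N₀ + excess
        ≈⟨ +-congʳ (*-congˡ (trans (+-congˡ (trans (incident-K' (F' c₀)) incident-c₀))
                                   (+-identityʳ N₀))) ⟨
      after c₀ + excess ∎
      where
      N₀ : Carrier
      N₀ = avoiding C K' (F' c₀)
      merged-weight : Σ R (λ v → ind R (C v) (w v * N₀)) ≈ w' c₀ * N₀
      merged-weight = begin
        Σ R (λ v → ind R (C v) (w v * N₀)) ≈⟨ Σ-cong (λ v → *-distribʳ-ind N₀ (C v) (w v)) ⟨
        Σ R (λ v → ind R (C v) (w v) * N₀) ≈⟨ *-distribʳ-Σ N₀ (λ v → ind R (C v) (w v)) ⟨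
        Σ R (λ v → ind R (C v) (w v)) * N₀ ≈⟨ *-congʳ w'-c₀ ⟨
        w' c₀ * N₀                         ∎

    twin-reduction : Wve R G allV w we ≈ Wve R G K' w' we' + excess
    twin-reduction = begin
      Wve R G allV w we
        ≈⟨ Wve-split C-independent allV w we ⟩
      Σ R before
        ≈⟨ Σ-cong (λ v → ind-+-ind-not (C v) (before v)) ⟨
      Σ R (λ v → ind R (C v) (before v) + ind R (not (C v)) (before v))
        ≈⟨ Σ-distrib-+ (λ v → ind R (C v) (before v)) (λ v → ind R (not (C v)) (before v)) ⟩
      Σ R (λ v → ind R (C v) (before v)) + Σ R (λ v → ind R (not (C v)) (before v))
        ≈⟨ +-cong inside-C (Σ-cong (λ v → ind-cong (not (C v)) (λ nCv →
             outside-C v (not-injective nCv)))) ⟩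
      (after c₀ + excess) + Σ R (λ v → ind R (not (C v)) (after v))
        ≈⟨ trans (+-comm _ _) (sym (+-assoc _ _ _)) ⟩
      (Σ R (λ v → ind R (not (C v)) (after v)) + after c₀) + excess
        ≈⟨ +-congʳ (trans (Wve-split C-independent K' w' we') (Σ-over-K' after)) ⟨
      Wve R G K' w' we' + excess ∎

theorem4p3 : {c ℓ : Level} (R : CommutativeSemiring c ℓ) →
  let open CommutativeSemiring R in
  {n : ℕ} (G : Graph n) → Connected G →
  (w : Fin n → Carrier) (we : Fin n → Fin n → Carrier) →
  (c₀ : Fin n) →
  let inC : Fin n → Bool
      inC v = sameN G v c₀
      keep' : Fin n → Bool
      keep' v = not (inC v) ∨ eqB v c₀
      k : ℕ
      k = countF inC
      s : ℕ
      s = countF (adj G c₀)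
  in
  (w' : Fin n → Carrier) (we' : Fin n → Fin n → Carrier) →
  w' c₀ ≈ Σ R (λ i → ind R (inC i) (w i)) →
  (∀ v → inC v ≡ false → w' v ≈ w v) →
  (∀ m → adj G c₀ m ≡ true →
     ew R we' c₀ m ≈ Σ R (λ i → ind R (inC i) (ew R we i m))) →
  (∀ x y → adj G x y ≡ true → inC x ≡ false → inC y ≡ false →
     ew R we' x y ≈ ew R we x y) →
  (Wve R G allV w we ≈
     Wve R G keep' w' we' +
     Σ R (λ i → ind R (inC i)
       (Σ R (λ r → ind R (inC r ∧ not (eqB r i))
         (Σ R (λ m → ind R (adj G r m) (w i * ew R we r m)))))))
  ×
  ((a b : Carrier) →
     (∀ i → inC i ≡ true → w i ≈ a) →
     (∀ r m → inC r ≡ true → adj G r m ≡ true → ew R we r m ≈ b) →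
     Wve R G allV w we ≈
       Wve R G keep' w' we' + (((a * b) * fromℕ R k) * fromℕ R (k ∸ 1)) * fromℕ R s)
-- Connectedness is not needed: deleting twins preserves reachability, so even the
-- junk distance n between unreachable vertices is unchanged.
theorem4p3 R G _ w we c₀ w' we' w'-c₀ w'-out we'-c₀ we'-out =
  reduction , λ a b w≈a we≈b → trans reduction (+-congˡ (excess-homogeneous a b w≈a we≈b))
  where
  open CommutativeSemiring R
  open Reduction R G c₀ w w' we we'
  reduction : Wve R G allV w we ≈ Wve R G (TwinClass.K' G c₀) w' we' + excess
  reduction = twin-reduction w'-c₀ w'-out we'-c₀ we'-out
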